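{- Let $f:\mathcal C\to\mathcal D$ be a surjective morphism of codes, and suppose that $\mathcal C$ and $\mathcal D$ have the same (finite) number of trunks. Then $f$ is an isomorphism.
   Context: A code is a subset $\mathcal C\subseteq 2^{[n]}$. For $\sigma\subseteq[n]$, $\mathrm{Tk}_{\mathcal C}(\sigma)=\{c\in\mathcal C\mid\sigma\subseteq c\}$. A trunk in $\mathcal C$ is a subset of $\mathcal C$ that is empty or equal to $\mathrm{Tk}_{\mathcal C}(\sigma)$ for some $\sigma\subseteq[n]$; the number of trunks is the number of distinct such subsets. A morphism between codes $\mathcal C\subseteq 2^{[n]}$ and $\mathcal D\subseteq 2^{[m]}$ is a function $f:\mathcal C\to\mathcal D$ such that $f^{ -1}(T)$ is a trunk in $\mathcal C$ for every trunk $T$ in $\mathcal D$. An isomorphism is a bijective morphism whose inverse is also a morphism. -}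

module Defs where

open import Level using (0ℓ)
open import Data.Bool using (Bool; T)
open import Data.Nat using (ℕ)
open import Data.Fin using (Fin)
open import Data.Fin.Subset using (Subset; _⊆_)
open import Data.Product using (Σ; ∃; _×_; _,_; proj₁)
open import Data.Sum using (_⊎_)
open import Relation.Nullary using (¬_)
open import Relation.Binary.PropositionalEquality using (_≡_)
open import Function.Bundles using (_⇔_)

-- A code C ⊆ 2^[n], given by its (decidable) membership function on
-- subsets of [n] = Fin n.
Code : ℕ → Set
Code n = Subset n → Bool

-- The codewords of C (T is proof-irrelevant, so this is a genuine subset).
CW : ∀ {n} → Code n → Set
CW {n} C = Σ (Subset n) (λ c → T (C c))

SubsetOf : ∀ {n} → Code n → Set₁
SubsetOf C = CW C → Set

Same : ∀ {n} {C : Code n} → SubsetOf C → SubsetOf C → Set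
Same {C = C} P Q = ∀ (c : CW C) → P c ⇔ Q c

Tk : ∀ {n} (C : Code n) → Subset n → SubsetOf C
Tk C σ c = σ ⊆ proj₁ c

IsTrunk : ∀ {n} (C : Code n) → SubsetOf C → Set
IsTrunk {n} C P = (∀ c → ¬ P c) ⊎ Σ (Subset n) (λ σ → Same {C = C} P (Tk C σ))

IsMorphism : ∀ {n m} (C : Code n) (D : Code m) → (CW C → CW D) → Set₁
IsMorphism C D f = ∀ (P : SubsetOf D) → IsTrunk D P → IsTrunk C (λ c → P (f c))

IsIsomorphism : ∀ {n m} (C : Code n) (D : Code m) → (CW C → CW D) → Set₁
IsIsomorphism C D f =
  IsMorphism C D f ×
  Σ (CW D → CW C) (λ g →
    (∀ x → g (f x) ≡ x) × (∀ y → f (g y) ≡ y) × IsMorphism D C g)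

Surjective : ∀ {A B : Set} → (A → B) → Set
Surjective {A} f = ∀ y → Σ A (λ x → f x ≡ y)

Trunk : ∀ {n} → Code n → Set₁
Trunk C = Σ (SubsetOf C) (IsTrunk C)

-- "C has exactly k trunks": an enumeration Fin k → trunks which is
-- injective and surjective up to extensional equality of subsets
-- (distinct trunks = distinct subsets of C).
NumTrunks : ∀ {n} → Code n → ℕ → Set₁
NumTrunks C k =
  Σ (Fin k → Trunk C) (λ t →
    (∀ i j → Same {C = C} (proj₁ (t i)) (proj₁ (t j)) → i ≡ j) ×
    (∀ (s : Trunk C) → Σ (Fin k) (λ i → Same {C = C} (proj₁ (t i)) (proj₁ s))))

-- Pulling back along f sends trunks of D to trunks of C, and since f is
-- surjective this pullback is injective on trunks. With equally many
-- trunks on both sides it is therefore onto: every trunk of C is f⁻¹ of a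
-- trunk of D. Applied to Tk_C(c) this separates the codewords, so f is
-- injective; and for the inverse g, g⁻¹(f⁻¹ Q) = Q, so g is a morphism.
module Submission where

open import Defs
open import Level using (_⊔_; 0ℓ) renaming (suc to lsuc)
open import Data.Bool.Properties using (T-irrelevant)
open import Data.Nat using (ℕ; zero; suc)
open import Data.Nat.Properties using (1+n≰n)
open import Data.Fin using (Fin; punchOut)
open import Data.Fin.Properties using (injective⇒≤; punchOut-injective; any?; _≟_)
open import Data.Fin.Subset using (_⊆_)
open import Data.Fin.Subset.Properties using (⊆-antisym)
open import Data.Product using (Σ; ∃; _×_; _,_; proj₁; proj₂)
open import Data.Sum using (inj₁; inj₂)
open import Function using (_∘_)
open import Function.Bundles using (_⇔_; Equivalence)
open import Function.Definitions using (Injective)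
open import Function.Properties.Equivalence using (⇔-isEquivalence)
open import Relation.Binary.Bundles using (Setoid)
open import Relation.Binary.Structures using (IsEquivalence)
open import Relation.Nullary using (yes; no)
open import Relation.Nullary.Negation using (contradiction)
open import Relation.Binary.PropositionalEquality using (_≡_; _≢_; refl; sym; cong; subst)

Fin-injective⇒surjective : ∀ {k} {h : Fin k → Fin k} →
  Injective _≡_ _≡_ h → ∀ j → ∃ λ i → h i ≡ j
Fin-injective⇒surjective {zero} _ ()
Fin-injective⇒surjective {suc k} {h} h-injective j with any? (λ i → h i ≟ j)
... | yes hit = hit
... | no miss = contradiction (injective⇒≤ punchOut-j∘h-injective) 1+n≰n
  where
  j≢h : ∀ i → j ≢ h i
  j≢h i j≡hi = miss (i , sym j≡hi)

  punchOut-j∘h-injective : Injective _≡_ _≡_ (λ i → punchOut (j≢h i))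
  punchOut-j∘h-injective eq = h-injective (punchOut-injective (j≢h _) (j≢h _) eq)

IsEnumeration : ∀ {a ℓ} (S : Setoid a ℓ) {k} → (Fin k → Setoid.Carrier S) → Set (a ⊔ ℓ)
IsEnumeration S e = (∀ i j → e i ≈ e j → i ≡ j) × (∀ x → ∃ λ i → e i ≈ x)
  where open Setoid S

module _ {a b ℓ₁ ℓ₂} (S : Setoid a ℓ₁) (T : Setoid b ℓ₂) where
  private
    module S = Setoid S
    module T = Setoid T

  injective⇒surjective-of-equal-size :
    ∀ {k} {e : Fin k → S.Carrier} {e′ : Fin k → T.Carrier} →
    IsEnumeration S e → IsEnumeration T e′ →
    (h : S.Carrier → T.Carrier) → (∀ x y → h x T.≈ h y → x S.≈ y) →
    ∀ y → Σ S.Carrier λ x → y T.≈ h x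
  injective⇒surjective-of-equal-size {e = e} {e′} (e-inj , e-surj) (_ , e′-surj) h h-inj y =
    let (j , e′j≈y) = e′-surj y
        (i , index-i≡j) = Fin-injective⇒surjective index-injective j
    in e i , T.trans (T.sym e′j≈y) (subst (λ l → e′ l T.≈ h (e i)) index-i≡j (index-spec i))
    where
    index : Fin _ → Fin _
    index i = proj₁ (e′-surj (h (e i)))

    index-spec : ∀ i → e′ (index i) T.≈ h (e i)
    index-spec i = proj₂ (e′-surj (h (e i)))

    index-injective : Injective _≡_ _≡_ index
    index-injective {i} {i′} eq = e-inj i i′ (h-inj (e i) (e i′) (T.trans
      (T.sym (index-spec i)) (subst (λ l → e′ l T.≈ h (e i′)) (sym eq) (index-spec i′))))

private
  module ⇔ = IsEquivalence (⇔-isEquivalence {ℓ = 0ℓ})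

module _ {n} {C : Code n} where

  Same-refl : ∀ {P : SubsetOf C} → Same P P
  Same-refl c = ⇔.refl

  Same-sym : ∀ {P Q : SubsetOf C} → Same P Q → Same Q P
  Same-sym P≈Q c = ⇔.sym (P≈Q c)

  Same-trans : ∀ {P Q R : SubsetOf C} → Same P Q → Same Q R → Same P R
  Same-trans P≈Q Q≈R c = ⇔.trans (P≈Q c) (Q≈R c)

  IsTrunk-resp-Same : ∀ {P Q : SubsetOf C} → Same P Q → IsTrunk C P → IsTrunk C Q
  IsTrunk-resp-Same P≈Q (inj₁ P-empty) = inj₁ λ c Qc → P-empty c (Equivalence.from (P≈Q c) Qc)
  IsTrunk-resp-Same P≈Q (inj₂ (σ , P≈Tkσ)) = inj₂ (σ , Same-trans (Same-sym P≈Q) P≈Tkσ)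

  principal-trunk : CW C → Trunk C
  principal-trunk c = Tk C (proj₁ c) , inj₂ (proj₁ c , Same-refl)

  CW-≡ : ∀ {x y : CW C} → proj₁ x ≡ proj₁ y → x ≡ y
  CW-≡ {x = c , _} refl = cong (c ,_) (T-irrelevant _ _)

trunk-setoid : ∀ {n} → Code n → Setoid (lsuc 0ℓ) 0ℓ
trunk-setoid C = record
  { Carrier = Trunk C
  ; _≈_ = λ s t → Same (proj₁ s) (proj₁ t)
  ; isEquivalence = record { refl = Same-refl ; sym = Same-sym ; trans = Same-trans }
  }

module _ {n m} {C : Code n} {D : Code m} (f : CW C → CW D) where

  preimage : IsMorphism C D f → Trunk D → Trunk C
  preimage f-mor t = proj₁ t ∘ f , f-mor (proj₁ t) (proj₂ t)

  Surjective⇒preimage-reflects-Same : Surjective f →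
    ∀ {P Q : SubsetOf D} → Same (P ∘ f) (Q ∘ f) → Same P Q
  Surjective⇒preimage-reflects-Same f-surj Pf≈Qf y with x , refl ← f-surj y = Pf≈Qf x

  principal-trunks-are-preimages⇒injective :
    (∀ x → Σ (SubsetOf D) λ Q → Same (Tk C (proj₁ x)) (Q ∘ f)) →
    ∀ x x′ → f x ≡ f x′ → x ≡ x′
  principal-trunks-are-preimages⇒injective Tk-preimage x x′ fx≡fx′ =
    CW-≡ (⊆-antisym (below x x′ fx≡fx′) (below x′ x (sym fx≡fx′)))
    where
    below : ∀ x x′ → f x ≡ f x′ → proj₁ x ⊆ proj₁ x′
    below x x′ fx≡fx′ with Q , Tk≈Qf ← Tk-preimage x =
      Equivalence.from (Tk≈Qf x′) (subst Q fx≡fx′ (Equivalence.to (Tk≈Qf x) (λ p → p)))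

  trunks-are-preimages⇒right-inverse-is-morphism :
    (∀ (s : Trunk C) → Σ (Trunk D) λ t → Same (proj₁ s) (proj₁ t ∘ f)) →
    (g : CW D → CW C) → (∀ y → f (g y) ≡ y) → IsMorphism D C g
  trunks-are-preimages⇒right-inverse-is-morphism trunk-preimage g fg≡id P P-trunk
    with (Q , Q-trunk) , P≈Qf ← trunk-preimage (P , P-trunk) =
    IsTrunk-resp-Same Q≈Pg Q-trunk
    where
    Q≈Pg : Same Q (P ∘ g)
    Q≈Pg y = subst (λ z → Q z ⇔ P (g y)) (fg≡id y) (⇔.sym (P≈Qf (g y)))

proposition3p16 : ∀ {n m} (C : Code n) (D : Code m) (f : CW C → CW D) →
    IsMorphism C D f → Surjective f →
    (k : ℕ) → NumTrunks C k → NumTrunks D k →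
    IsIsomorphism C D f
proposition3p16 C D f f-mor f-surj _ (enumC , enumC-is) (enumD , enumD-is) =
  f-mor , g , gf≡id , fg≡id ,
  trunks-are-preimages⇒right-inverse-is-morphism f trunk-preimage g fg≡id
  where
  trunk-preimage : ∀ (s : Trunk C) → Σ (Trunk D) λ t → Same (proj₁ s) (proj₁ t ∘ f)
  trunk-preimage = injective⇒surjective-of-equal-size (trunk-setoid D) (trunk-setoid C)
    {e = enumD} {enumC} enumD-is enumC-is (preimage f f-mor)
    (λ _ _ → Surjective⇒preimage-reflects-Same f f-surj)

  g : CW D → CW C
  g y = proj₁ (f-surj y)

  fg≡id : ∀ y → f (g y) ≡ y
  fg≡id y = proj₂ (f-surj y)

  Tk-preimage : ∀ c → Σ (SubsetOf D) λ Q → Same (Tk C (proj₁ c)) (Q ∘ f)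
  Tk-preimage c = let ((Q , _) , Tk≈Qf) = trunk-preimage (principal-trunk c) in Q , Tk≈Qf

  gf≡id : ∀ x → g (f x) ≡ x
  gf≡id x = principal-trunks-are-preimages⇒injective f Tk-preimage (g (f x)) x (fg≡id (f x))
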